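{- Let $G$ be a countably infinite group with identity $e$ such that for each $g\in G\setminus\{e\}$ the set $\{x\in G:x^2=g\}$ is finite. Then for any $X_0\subseteq G$ with $X_0=X_0^{ -1}$ and $e\in X_0$, there exists a sequence $(X_n)_{n\in\omega}$ of subsets of $G$ (starting with the given $X_0$) such that $\Delta(X_{n+1})=X_n$ for all $n\in\omega$ and $X_m\cap X_n=\{e\}$ whenever $0<m<n<\omega$.
   Context: For $X\subseteq G$, $\Delta(X)=\{g\in G:|gX\cap X|=\infty\}$. -}

module Defs where

open import Level using (0ℓ)
open import Data.Nat using (ℕ; zero; _<_)
open import Data.Product using (Σ; ∃; _×_; _,_)
open import Data.List using (List)
open import Data.List.Membership.Propositional using (_∈_)
open import Relation.Nullary using (¬_)
open import Relation.Binary.PropositionalEquality using (_≡_; _≢_)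
open import Function.Bundles using (_⇔_; _↔_)
open import Algebra.Bundles using (Group)

Subset : Set → Set₁
Subset A = A → Set

_≐_ : {A : Set} → Subset A → Subset A → Set
X ≐ Y = ∀ a → X a ⇔ Y a

Finite : {A : Set} → Subset A → Set
Finite {A} X = Σ (List A) λ l → ∀ a → X a → a ∈ l

Infinite : {A : Set} → Subset A → Set
Infinite X = ¬ Finite X

CountablyInfinite : Set → Set
CountablyInfinite A = ℕ ↔ A

module GroupSubsets (G : Group 0ℓ 0ℓ) where
  open Group G

  _·S_ : Carrier → Subset Carrier → Subset Carrier
  (g ·S X) y = ∃ λ x → X x × y ≡ g ∙ x

  _∩S_ : Subset Carrier → Subset Carrier → Subset Carrier
  (X ∩S Y) y = X y × Y y

  invS : Subset Carrier → Subset Carrier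
  invS X y = ∃ λ x → X x × y ≡ x ⁻¹

  ｛e｝ : Subset Carrier
  ｛e｝ y = y ≡ ε

  Δ : Subset Carrier → Subset Carrier
  Δ X g = Infinite ((g ·S X) ∩S X)

  sqrts : Carrier → Subset Carrier
  sqrts g x = x ∙ x ≡ g

module Submission where

-- Theorem 5.4.  The sets Xₙ₊₁ are built in stages k = 0, 1, ...; a schedule
-- visits every pair (n, i) infinitely often.  A stage serving (n, i) takes as
-- centre x the i-th group element if it is already known to lie in Xₙ (else
-- x = e), picks a point a, and puts a, a⁻¹, xa, (xa)⁻¹ into Xₙ₊₁.  As
-- xa · a⁻¹ = x and every x ∈ Xₙ is served forever, Xₙ ⊆ Δ(Xₙ₊₁).  The point a
-- is chosen fresh and such that every quotient st⁻¹ of a new element s by an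
-- element t produced so far is safe: e, x^{±1}, or of index above k.  Then
-- each g ∉ Xₙ is a quotient of finitely many pairs only, so Δ(Xₙ₊₁) ⊆ Xₙ.
--
-- Good points exist because each requirement says that some map of a avoids
-- a finite set, which holds for cofinitely many a if the map has finite
-- fibres there (translations, inversion, squaring off e).  The exception is
-- the conjugate a⁻¹xa: if the centralizer of x is finite, conjugation is
-- finite-to-one too; otherwise we take a in it, where a⁻¹xa = x.

open import Defs
open import Level using (0ℓ)
open import Data.Nat using (ℕ; zero; suc; _<_; _≤_; _+_; _⊔_; z≤n; s≤s)
open import Data.Nat.Properties
  using (≤-refl; ≤-trans; ≤-reflexive; <⇒≤; ≤⇒≯; ≰⇒>; ≮⇒≥; <-cmp; _<?_; <-irrefl; m≤n⇒m<n∨m≡n;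
         +-suc; +-identityʳ; suc-injective; m≤m⊔n; m≤n⊔m; m≤m+n; m≤n+m)
open import Data.Product using (Σ; _×_; _,_; proj₁; proj₂)
open import Data.Sum using (_⊎_; inj₁; inj₂)
open import Data.Unit using (⊤; tt)
open import Data.Empty using (⊥-elim)
open import Data.List using (List; []; _∷_; _++_; map; concatMap; upTo)
open import Data.List.Relation.Unary.Any using (Any; here; there)
open import Data.List.Membership.Propositional using (_∈_; _∉_; lose; find)
open import Data.List.Membership.Propositional.Properties
  using (∈-map⁺; ∈-map⁻; ∈-++⁺ˡ; ∈-++⁺ʳ; ∈-++⁻; ∈-concatMap⁺; ∈-upTo⁺)
open import Relation.Nullary using (¬_; yes; no; contradiction)
open import Relation.Binary.Definitions using (tri<; tri≈; tri>)
open import Relation.Binary.PropositionalEquality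
  using (_≡_; _≢_; refl; sym; trans; cong; subst; module ≡-Reasoning)
open import Function using (_∘_; id)
open import Function.Bundles using (Inverse; Equivalence; mk⇔)
open import Algebra.Bundles using (Group)
open import Axiom.ExcludedMiddle using (ExcludedMiddle)
import Algebra.Properties.Group as GroupProperties

fibre : {A B : Set} → (A → B) → B → Subset A
fibre f y a = f a ≡ y

FiniteFibresOn : {A B : Set} → Subset B → (A → B) → Set
FiniteFibresOn Y f = ∀ y → Y y → Finite (fibre f y)

FiniteFibres : {A B : Set} → (A → B) → Set
FiniteFibres f = ∀ y → Finite (fibre f y)

Cofinite : {A : Set} → Subset A → Set
Cofinite {A} P = Σ (List A) λ L → ∀ a → a ∉ L → P a

finite-⊆ : {A : Set} {Y Z : Subset A} → (∀ a → Y a → Z a) → Finite Z → Finite Y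
finite-⊆ Y⊆Z (L , cover) = L , λ a Ya → cover a (Y⊆Z a Ya)

finite-preimage : ExcludedMiddle 0ℓ → {A B : Set} {Y : Subset B} (f : A → B) →
  Finite Y → FiniteFibresOn Y f → Finite (λ a → Y (f a))
finite-preimage em {A} {B} {Y} f (L , cover) fibres =
  concatMap fibreList L , λ a Yfa → ∈-concatMap⁺ fibreList (lose (cover (f a) Yfa) (fibreList-∋ a Yfa))
  where
  fibreList : B → List A
  fibreList y with em {Y y}
  ... | yes Yy = proj₁ (fibres y Yy)
  ... | no _ = []
  fibreList-∋ : ∀ a → Y (f a) → a ∈ fibreList (f a)
  fibreList-∋ a Yfa with em {Y (f a)}
  ... | yes Yy = proj₂ (fibres (f a) Yy) a refl
  ... | no ¬Yy = contradiction Yfa ¬Yy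

invertible-fibres : {A B : Set} {f : A → B} (g : B → A) → (∀ a → g (f a) ≡ a) → FiniteFibres f
invertible-fibres g g∘f≡id y = g y ∷ [] , λ a fa≡y → here (trans (sym (g∘f≡id a)) (cong g fa≡y))

fibres-∘ : ExcludedMiddle 0ℓ → {A B D : Set} {Y : Subset D} {h : B → D} {f : A → B} →
  FiniteFibresOn Y h → FiniteFibres f → FiniteFibresOn Y (h ∘ f)
fibres-∘ em {f = f} h-fibres f-fibres y Yy = finite-preimage em f (h-fibres y Yy) (λ z _ → f-fibres z)

cofinite-avoid : ExcludedMiddle 0ℓ → {A B : Set} {Y : Subset B} (f : A → B) →
  Finite Y → FiniteFibresOn Y f → Cofinite (λ a → ¬ Y (f a))
cofinite-avoid em f finY fibres with finite-preimage em f finY fibres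
... | L , cover = L , λ a a∉L Yfa → a∉L (cover a Yfa)

cofinite-× : {A : Set} {P Q : Subset A} → Cofinite P → Cofinite Q → Cofinite (λ a → P a × Q a)
cofinite-× (L , p) (M , q) = L ++ M , λ a a∉ → p a (a∉ ∘ ∈-++⁺ˡ) , q a (a∉ ∘ ∈-++⁺ʳ L)

cofinite-all : {A I : Set} {P : I → Subset A} (is : List I) →
  (∀ i → i ∈ is → Cofinite (P i)) → Cofinite (λ a → ∀ i → i ∈ is → P i a)
cofinite-all [] _ = [] , λ _ _ _ ()
cofinite-all {P = P} (i ∷ is) cof with cof i (here refl) | cofinite-all {P = P} is (λ j j∈ → cof j (there j∈))
... | L , p | M , q = L ++ M , holds
  where
  holds : ∀ a → a ∉ L ++ M → ∀ j → j ∈ i ∷ is → P j a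
  holds a a∉ j (here refl) = p a (a∉ ∘ ∈-++⁺ˡ)
  holds a a∉ j (there j∈) = q a (a∉ ∘ ∈-++⁺ʳ L) j j∈

infinite-meets-cofinite : ExcludedMiddle 0ℓ → {A : Set} {Q P : Subset A} →
  Infinite Q → Cofinite P → Σ A λ a → Q a × P a
infinite-meets-cofinite em {A} {Q} {P} infinite (L , p) with em {Σ A λ a → Q a × P a}
... | yes found = found
... | no none = ⊥-elim (infinite (L , Q⊆L))
  where
  Q⊆L : ∀ a → Q a → a ∈ L
  Q⊆L a Qa with em {a ∈ L}
  ... | yes a∈L = a∈L
  ... | no a∉L = ⊥-elim (none (a , Qa , p a a∉L))

module Enumeration {A : Set} (enumeration : CountablyInfinite A) where
  enum : ℕ → A
  enum = Inverse.to enumeration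

  index : A → ℕ
  index = Inverse.from enumeration

  enum-index : ∀ a → enum (index a) ≡ a
  enum-index = Inverse.strictlyInverseˡ enumeration

  index-enum : ∀ i → index (enum i) ≡ i
  index-enum = Inverse.strictlyInverseʳ enumeration

  initial-finite : ∀ k → Finite (λ a → index a ≤ k)
  initial-finite k = map enum (upTo (suc k)) , λ a le →
    subst (_∈ map enum (upTo (suc k))) (enum-index a) (∈-map⁺ enum (∈-upTo⁺ (s≤s le)))

  finite-bounded : {Y : Subset A} → Finite Y → Σ ℕ λ N → ∀ a → Y a → index a < N
  finite-bounded (L , cover) = bound L , λ a Ya → bound-> (cover a Ya)
    where
    bound : List A → ℕ
    bound [] = 0
    bound (b ∷ L) = suc (index b) ⊔ bound L
    bound-> : ∀ {a L} → a ∈ L → index a < bound L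
    bound-> {L = b ∷ L} (here refl) = m≤m⊔n (suc (index b)) (bound L)
    bound-> {L = b ∷ L} (there a∈L) = ≤-trans (bound-> a∈L) (m≤n⊔m (suc (index b)) (bound L))

  unbounded-infinite : {Y : Subset A} → (∀ N → Σ A λ a → Y a × N ≤ index a) → Infinite Y
  unbounded-infinite unbounded finY with finite-bounded finY
  ... | N , below with unbounded N
  ... | a , Ya , N≤ia = ≤⇒≯ N≤ia (below a Ya)

  everything-infinite : Infinite {A} (λ _ → ⊤)
  everything-infinite = unbounded-infinite λ N → enum N , tt , ≤-reflexive (sym (index-enum N))

-- A recurrent schedule: a sequence in ℕ × ℕ taking every value infinitely often.

-- Walk through ℕ × ℕ diagonal by diagonal: (0,0), (1,0), (0,1), (2,0), ...
next-on-diagonal : ℕ × ℕ → ℕ × ℕ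
next-on-diagonal (zero , b) = suc b , zero
next-on-diagonal (suc a , b) = a , suc b

unpair : ℕ → ℕ × ℕ
unpair zero = 0 , 0
unpair (suc k) = next-on-diagonal (unpair k)

unpair-snd-≤ : ∀ k → proj₂ (unpair k) ≤ k
unpair-snd-≤ zero = z≤n
unpair-snd-≤ (suc k) = step (unpair k) (s≤s (unpair-snd-≤ k))
  where
  step : ∀ p → suc (proj₂ p) ≤ suc k → proj₂ (next-on-diagonal p) ≤ suc k
  step (zero , b) _ = z≤n
  step (suc a , b) le = le

unpair-onto : ∀ s a b → a + b ≡ s → Σ ℕ λ k → unpair k ≡ (a , b)
unpair-onto s zero zero _ = 0 , refl
unpair-onto s a (suc b) a+b≡s with unpair-onto s (suc a) b (trans (sym (+-suc a b)) a+b≡s)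
... | k , p = suc k , cong next-on-diagonal p
unpair-onto zero (suc a) zero ()
unpair-onto (suc s) (suc a) zero a+0≡s with unpair-onto s zero a (trans (sym (+-identityʳ a)) (suc-injective a+0≡s))
... | k , p = suc k , cong next-on-diagonal p

schedule : ℕ → ℕ × ℕ
schedule k = unpair (proj₁ (unpair k))

-- Every pair is scheduled at arbitrarily late stages: (n, i) is visited at
-- the stages k with unpair k = (j, N), where unpair j = (n, i).
schedule-recurrent : ∀ p N → Σ ℕ λ k → N ≤ k × schedule k ≡ p
schedule-recurrent (n , i) N with unpair-onto _ n i refl
... | j , unpair-j with unpair-onto _ j N refl
... | k , unpair-k =
  k , subst (_≤ k) (cong proj₂ unpair-k) (unpair-snd-≤ k) , trans (cong (unpair ∘ proj₁) unpair-k) unpair-j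

module GroupAlgebra (G : Group 0ℓ 0ℓ) (≈⇒≡ : ∀ {x y} → Group._≈_ G x y → x ≡ y) where
  open Group G using (_∙_; _⁻¹) renaming (Carrier to C; ε to e)
  private
    module G = Group G
    module P = GroupProperties G
  open ≡-Reasoning

  assoc : ∀ u v w → (u ∙ v) ∙ w ≡ u ∙ (v ∙ w)
  assoc u v w = ≈⇒≡ (G.assoc u v w)

  identityˡ : ∀ u → e ∙ u ≡ u
  identityˡ u = ≈⇒≡ (G.identityˡ u)

  identityʳ : ∀ u → u ∙ e ≡ u
  identityʳ u = ≈⇒≡ (G.identityʳ u)

  inverseʳ : ∀ u → u ∙ u ⁻¹ ≡ e
  inverseʳ u = ≈⇒≡ (G.inverseʳ u)

  ⁻¹-involutive : ∀ u → u ⁻¹ ⁻¹ ≡ u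
  ⁻¹-involutive u = ≈⇒≡ (P.⁻¹-involutive u)

  ⁻¹-anti-homo : ∀ u v → (u ∙ v) ⁻¹ ≡ v ⁻¹ ∙ u ⁻¹
  ⁻¹-anti-homo u v = ≈⇒≡ (P.⁻¹-anti-homo-∙ u v)

  e⁻¹≡e : e ⁻¹ ≡ e
  e⁻¹≡e = ≈⇒≡ P.ε⁻¹≈ε

  cancelˡ : ∀ u v → u ⁻¹ ∙ (u ∙ v) ≡ v
  cancelˡ u v = begin
    u ⁻¹ ∙ (u ∙ v)  ≡⟨ sym (assoc _ _ _) ⟩
    (u ⁻¹ ∙ u) ∙ v  ≡⟨ cong (_∙ v) (≈⇒≡ (G.inverseˡ u)) ⟩
    e ∙ v           ≡⟨ identityˡ v ⟩
    v               ∎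

  cancelˡ′ : ∀ u v → u ∙ (u ⁻¹ ∙ v) ≡ v
  cancelˡ′ u v = trans (cong (λ w → w ∙ (u ⁻¹ ∙ v)) (sym (⁻¹-involutive u))) (cancelˡ (u ⁻¹) v)

  cancelʳ : ∀ u v → (u ∙ v) ∙ v ⁻¹ ≡ u
  cancelʳ u v = begin
    (u ∙ v) ∙ v ⁻¹  ≡⟨ assoc _ _ _ ⟩
    u ∙ (v ∙ v ⁻¹)  ≡⟨ cong (u ∙_) (inverseʳ v) ⟩
    u ∙ e           ≡⟨ identityʳ u ⟩
    u               ∎

  cancelʳ′ : ∀ u v → (u ∙ v ⁻¹) ∙ v ≡ u
  cancelʳ′ u v = trans (cong ((u ∙ v ⁻¹) ∙_) (sym (⁻¹-involutive v))) (cancelʳ u (v ⁻¹))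

  quotient-⁻¹ : ∀ u v → (u ∙ v ⁻¹) ⁻¹ ≡ v ∙ u ⁻¹
  quotient-⁻¹ u v = trans (⁻¹-anti-homo u (v ⁻¹)) (cong (_∙ u ⁻¹) (⁻¹-involutive v))

  solve-left : ∀ {v w y} → v ∙ w ≡ y → w ≡ v ⁻¹ ∙ y
  solve-left {v} {w} vw≡y = trans (sym (cancelˡ v w)) (cong (v ⁻¹ ∙_) vw≡y)

  nontrivial-left-quotient : ∀ {v y} → y ≢ v → v ⁻¹ ∙ y ≢ e
  nontrivial-left-quotient {v} {y} y≢v v⁻¹y≡e =
    y≢v (trans (sym (cancelˡ′ v y)) (trans (cong (v ∙_) v⁻¹y≡e) (identityʳ v)))

  same-conjugate : ∀ x a a₀ → a ⁻¹ ∙ (x ∙ a) ≡ a₀ ⁻¹ ∙ (x ∙ a₀) →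
    (a ∙ a₀ ⁻¹) ∙ x ≡ x ∙ (a ∙ a₀ ⁻¹)
  same-conjugate x a a₀ eq = begin
    (a ∙ a₀ ⁻¹) ∙ x                       ≡⟨ assoc _ _ _ ⟩
    a ∙ (a₀ ⁻¹ ∙ x)                       ≡⟨ cong (λ z → a ∙ (a₀ ⁻¹ ∙ z)) (sym (cancelʳ x a₀)) ⟩
    a ∙ (a₀ ⁻¹ ∙ ((x ∙ a₀) ∙ a₀ ⁻¹))      ≡⟨ cong (a ∙_) (sym (assoc _ _ _)) ⟩
    a ∙ ((a₀ ⁻¹ ∙ (x ∙ a₀)) ∙ a₀ ⁻¹)      ≡⟨ sym (assoc _ _ _) ⟩
    (a ∙ (a₀ ⁻¹ ∙ (x ∙ a₀))) ∙ a₀ ⁻¹      ≡⟨ cong (λ z → (a ∙ z) ∙ a₀ ⁻¹) (sym eq) ⟩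
    (a ∙ (a ⁻¹ ∙ (x ∙ a))) ∙ a₀ ⁻¹        ≡⟨ cong (_∙ a₀ ⁻¹) (cancelˡ′ a (x ∙ a)) ⟩
    (x ∙ a) ∙ a₀ ⁻¹                       ≡⟨ assoc _ _ _ ⟩
    x ∙ (a ∙ a₀ ⁻¹)                       ∎

  central-conjugate : ∀ x a → a ∙ x ≡ x ∙ a → a ⁻¹ ∙ (x ∙ a) ≡ x
  central-conjugate x a ax≡xa = trans (cong (a ⁻¹ ∙_) (sym ax≡xa)) (cancelˡ a x)

-- The good-point lemma.

module GoodPoints
  (em : ExcludedMiddle 0ℓ) (G : Group 0ℓ 0ℓ)
  (≈⇒≡ : ∀ {x y} → Group._≈_ G x y → x ≡ y)
  (enumeration : CountablyInfinite (Group.Carrier G))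
  (few-roots : ∀ g → g ≢ Group.ε G → Finite (GroupSubsets.sqrts G g)) where
  open Group G using (_∙_; _⁻¹) renaming (Carrier to C; ε to e)
  open GroupAlgebra G ≈⇒≡
  open Enumeration enumeration

  -- The elements e, x, x⁻¹, which may occur as quotients without harm.
  trivials : C → List C
  trivials x = e ∷ x ∷ x ⁻¹ ∷ []

  trivials-⁻¹ : ∀ {x q} → q ∈ trivials x → q ⁻¹ ∈ trivials x
  trivials-⁻¹ (here refl) = here e⁻¹≡e
  trivials-⁻¹ (there (here refl)) = there (there (here refl))
  trivials-⁻¹ (there (there (here refl))) = there (here (⁻¹-involutive _))

  -- A step with centre x and point a contributes a, a⁻¹, xa and (xa)⁻¹;
  -- these are the images of a under the four "shapes".
  shapes : C → List (C → C)
  shapes x = id ∷ _⁻¹ ∷ (x ∙_) ∷ (_⁻¹ ∘ (x ∙_)) ∷ []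

  quad : C → C → List C
  quad x a = map (λ σ → σ a) (shapes x)

  quad-shape : ∀ {x a s} → s ∈ quad x a → Σ (C → C) λ σ → σ ∈ shapes x × s ≡ σ a
  quad-shape {x} {a} = ∈-map⁻ (λ σ → σ a) {xs = shapes x}

  -- The contribution is closed under inversion, which keeps Xₙ₊₁ symmetric.
  quad-⁻¹ : ∀ {x a s} → s ∈ quad x a → s ⁻¹ ∈ quad x a
  quad-⁻¹ (here refl) = there (here refl)
  quad-⁻¹ (there (here refl)) = here (⁻¹-involutive _)
  quad-⁻¹ (there (there (here refl))) = there (there (there (here refl)))
  quad-⁻¹ (there (there (there (here refl)))) = there (there (here (⁻¹-involutive _)))

  shape-fibres : ∀ {x σ} → σ ∈ shapes x → FiniteFibres σ
  shape-fibres (here refl) = invertible-fibres id (λ _ → refl)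
  shape-fibres (there (here refl)) = invertible-fibres _⁻¹ ⁻¹-involutive
  shape-fibres {x} (there (there (here refl))) = invertible-fibres (x ⁻¹ ∙_) (cancelˡ x)
  shape-fibres {x} (there (there (there (here refl)))) =
    invertible-fibres (λ y → x ⁻¹ ∙ y ⁻¹) (λ a → trans (cong (x ⁻¹ ∙_) (⁻¹-involutive _)) (cancelˡ x a))

  -- The two shapes a and xa whose (shifted) squares occur as quotients.
  roots : C → List (C → C)
  roots x = id ∷ (x ∙_) ∷ []

  root-fibres : ∀ {x σ} → σ ∈ roots x → FiniteFibres σ
  root-fibres {x} (here refl) = shape-fibres {x = x} (here refl)
  root-fibres (there (here refl)) = shape-fibres (there (there (here refl)))

  -- The quotients s t⁻¹ of two contributed elements are of the following
  -- forms: trivial, a shifted square v (σa)², the conjugate a⁻¹xa, or an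
  -- inverse of one of these.
  data Form (x a : C) : C → Set where
    trivial : ∀ {q} → q ∈ trivials x → Form x a q
    square  : ∀ {v σ} → v ∈ trivials x → σ ∈ roots x → Form x a (v ∙ (σ a ∙ σ a))
    conj    : Form x a (a ⁻¹ ∙ (x ∙ a))
    inverse : ∀ {q} → Form x a q → Form x a (q ⁻¹)

  quad-quotient : ∀ {x a s t} → s ∈ quad x a → t ∈ quad x a → Form x a (s ∙ t ⁻¹)
  quad-quotient {x} {a} s∈ t∈ = quotients s∈ t∈
    where
    b = x ∙ a
    t₀ : e ∈ trivials x
    t₀ = here refl
    t₁ : x ∈ trivials x
    t₁ = there (here refl)
    t₂ : x ⁻¹ ∈ trivials x
    t₂ = there (there (here refl))
    r₀ : id ∈ roots x
    r₀ = here refl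
    r₁ : (x ∙_) ∈ roots x
    r₁ = there (here refl)
    as : ∀ {q r} → q ≡ r → Form x a q → Form x a r
    as = subst (Form x a)
    unit-square : ∀ u → e ∙ (u ∙ u) ≡ u ∙ u ⁻¹ ⁻¹
    unit-square u = trans (identityˡ _) (cong (u ∙_) (sym (⁻¹-involutive u)))
    unit-square⁻¹ : ∀ u → (e ∙ (u ∙ u)) ⁻¹ ≡ u ⁻¹ ∙ u ⁻¹
    unit-square⁻¹ u = trans (cong _⁻¹ (identityˡ _)) (⁻¹-anti-homo u u)
    shifted-square : x ⁻¹ ∙ (b ∙ b) ≡ a ∙ b
    shifted-square = trans (sym (assoc _ _ _)) (cong (_∙ b) (cancelˡ x a))
    quotients : ∀ {s t} → s ∈ quad x a → t ∈ quad x a → Form x a (s ∙ t ⁻¹)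
    quotients (here refl) (here refl) = trivial (here (inverseʳ a))
    quotients (here refl) (there (here refl)) = as (unit-square a) (square t₀ r₀)
    quotients (here refl) (there (there (here refl))) =
      trivial (there (there (here (trans (cong (a ∙_) (⁻¹-anti-homo x a)) (cancelˡ′ a _)))))
    quotients (here refl) (there (there (there (here refl)))) =
      as (trans shifted-square (cong (a ∙_) (sym (⁻¹-involutive b)))) (square t₂ r₁)
    quotients (there (here refl)) (here refl) = as (unit-square⁻¹ a) (inverse (square t₀ r₀))
    quotients (there (here refl)) (there (here refl)) = trivial (here (inverseʳ _))
    quotients (there (here refl)) (there (there (here refl))) =
      as (trans (cong _⁻¹ (sym (assoc x a a))) (⁻¹-anti-homo b a)) (inverse (square t₁ r₀))
    quotients (there (here refl)) (there (there (there (here refl)))) =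
      as (cong (a ⁻¹ ∙_) (sym (⁻¹-involutive b))) conj
    quotients (there (there (here refl))) (here refl) = trivial (there (here (cancelʳ x a)))
    quotients (there (there (here refl))) (there (here refl)) =
      as (trans (sym (assoc x a a)) (cong (b ∙_) (sym (⁻¹-involutive a)))) (square t₁ r₀)
    quotients (there (there (here refl))) (there (there (here refl))) = trivial (here (inverseʳ b))
    quotients (there (there (here refl))) (there (there (there (here refl)))) =
      as (unit-square b) (square t₀ r₁)
    quotients (there (there (there (here refl)))) (here refl) =
      as (trans (cong _⁻¹ shifted-square) (⁻¹-anti-homo a b)) (inverse (square t₂ r₁))
    quotients (there (there (there (here refl)))) (there (here refl)) =
      as (⁻¹-anti-homo (a ⁻¹) b) (inverse conj)
    quotients (there (there (there (here refl)))) (there (there (here refl))) =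
      as (unit-square⁻¹ b) (inverse (square t₀ r₁))
    quotients (there (there (there (here refl)))) (there (there (there (here refl)))) =
      trivial (here (inverseʳ _))

  Dangerous : ℕ → C → Subset C
  Dangerous k x q = (index q ≤ k ⊎ index (q ⁻¹) ≤ k) × q ∉ trivials x

  Safe : ℕ → C → Subset C
  Safe k x q = ¬ Dangerous k x q

  dangerous-finite : ∀ k x → Finite (Dangerous k x)
  dangerous-finite k x with initial-finite k
  ... | L , cover = L ++ map _⁻¹ L , covered
    where
    covered : ∀ q → Dangerous k x q → q ∈ L ++ map _⁻¹ L
    covered q (inj₁ small , _) = ∈-++⁺ˡ (cover q small)
    covered q (inj₂ small , _) =
      ∈-++⁺ʳ L (subst (_∈ map _⁻¹ L) (⁻¹-involutive q) (∈-map⁺ _⁻¹ (cover (q ⁻¹) small)))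

  safe-⁻¹ : ∀ {k x q} → Safe k x q → Safe k x (q ⁻¹)
  safe-⁻¹ {k} {x} {q} safe (small , nontrivial) = safe (swap small , nontrivial ∘ trivials-⁻¹)
    where
    swap : index (q ⁻¹) ≤ k ⊎ index (q ⁻¹ ⁻¹) ≤ k → index q ≤ k ⊎ index (q ⁻¹) ≤ k
    swap (inj₁ small) = inj₂ small
    swap (inj₂ small) = inj₁ (subst (λ r → index r ≤ k) (⁻¹-involutive q) small)

  SquaresSafe : ℕ → C → C → Set
  SquaresSafe k x a = ∀ v → v ∈ trivials x → ∀ σ → σ ∈ roots x → Safe k x (v ∙ (σ a ∙ σ a))

  form-safe : ∀ {k x a q} → SquaresSafe k x a → Safe k x (a ⁻¹ ∙ (x ∙ a)) → Form x a q → Safe k x q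
  form-safe _ _ (trivial q∈) (_ , q∉) = q∉ q∈
  form-safe squares _ (square v∈ σ∈) = squares _ v∈ _ σ∈
  form-safe _ conj-safe conj = conj-safe
  form-safe squares conj-safe (inverse form) = safe-⁻¹ (form-safe squares conj-safe form)

  -- u ↦ v u² is finite-to-one away from v: there u² = v⁻¹y ≠ e, which has
  -- finitely many square roots.
  shifted-square-fibres : ∀ v → FiniteFibresOn (_≢ v) (λ u → v ∙ (u ∙ u))
  shifted-square-fibres v y y≢v =
    finite-⊆ (λ u vuu≡y → solve-left vuu≡y) (few-roots (v ⁻¹ ∙ y) (nontrivial-left-quotient y≢v))

  square-fibres : ∀ {k x v σ} → v ∈ trivials x → σ ∈ roots x →
    FiniteFibresOn (Dangerous k x) (λ a → v ∙ (σ a ∙ σ a))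
  square-fibres {v = v} v∈ σ∈ y (_ , y∉) =
    fibres-∘ em (shifted-square-fibres v) (root-fibres σ∈) y (λ y≡v → y∉ (subst (_∈ _) (sym y≡v) v∈))

  -- All requirements on the new point a except the one on a⁻¹xa: the
  -- contributed elements are new and safe against the used elements P,
  -- xa has index above k, and the shifted squares are safe.
  Generic : ℕ → List C → C → Subset C
  Generic k P x a =
      (∀ σ → σ ∈ shapes x → σ a ∉ P × (∀ p → p ∈ P → Safe k x (σ a ∙ p ⁻¹)))
    × ¬ index (x ∙ a) ≤ k
    × SquaresSafe k x a

  generic-cofinite : ∀ k P x → Cofinite (Generic k P x)
  generic-cofinite k P x = cofinite-× (cofinite-all (shapes x) shape-generic) (cofinite-× large squares)
    where
    translate-fibres : ∀ p → FiniteFibres (_∙ p ⁻¹)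
    translate-fibres p = invertible-fibres (_∙ p) (λ c → cancelʳ′ c p)
    shape-generic : ∀ σ → σ ∈ shapes x → Cofinite (λ a → σ a ∉ P × (∀ p → p ∈ P → Safe k x (σ a ∙ p ⁻¹)))
    shape-generic σ σ∈ = cofinite-×
      (cofinite-avoid em σ (P , λ _ p∈ → p∈) (λ y _ → shape-fibres σ∈ y))
      (cofinite-all P λ p _ → cofinite-avoid em (λ a → σ a ∙ p ⁻¹) (dangerous-finite k x)
        (fibres-∘ em (λ y _ → translate-fibres p y) (shape-fibres σ∈)))
    large : Cofinite (λ a → ¬ index (x ∙ a) ≤ k)
    large = cofinite-avoid em (x ∙_) (initial-finite k) (λ y _ → shape-fibres {x} (there (there (here refl))) y)
    squares : Cofinite (SquaresSafe k x)
    squares = cofinite-all (trivials x) λ v v∈ → cofinite-all (roots x) λ σ σ∈ →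
      cofinite-avoid em (λ a → v ∙ (σ a ∙ σ a)) (dangerous-finite k x) (square-fibres v∈ σ∈)

  Centralizer : C → Subset C
  Centralizer x c = c ∙ x ≡ x ∙ c

  -- If the centralizer Z of x is finite, conjugation a ↦ a⁻¹xa is
  -- finite-to-one: its fibre through a₀ is Z a₀.
  conjugation-fibres : ∀ x → Finite (Centralizer x) → FiniteFibres (λ a → a ⁻¹ ∙ (x ∙ a))
  conjugation-fibres x (Z , cover) y with em {Σ C λ a₀ → a₀ ⁻¹ ∙ (x ∙ a₀) ≡ y}
  ... | yes (a₀ , a₀↦y) = map (_∙ a₀) Z , λ a a↦y →
    subst (_∈ map (_∙ a₀) Z) (cancelʳ′ a a₀)
      (∈-map⁺ (_∙ a₀) (cover _ (same-conjugate x a a₀ (trans a↦y (sym a₀↦y)))))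
  ... | no empty = [] , λ a a↦y → ⊥-elim (empty (a , a↦y))

  -- Every cofinite set contains a point a with a⁻¹xa safe: if the
  -- centralizer of x is finite this is again a cofinite condition, and
  -- otherwise the centralizer meets the set and there a⁻¹xa = x.
  safe-conjugate : ∀ k x {Q : Subset C} → Cofinite Q → Σ C λ a → Q a × Safe k x (a ⁻¹ ∙ (x ∙ a))
  safe-conjugate k x cofQ with em {Finite (Centralizer x)}
  ... | yes finite with infinite-meets-cofinite em everything-infinite
        (cofinite-× cofQ (cofinite-avoid em _ (dangerous-finite k x) (λ y _ → conjugation-fibres x finite y)))
  ...   | a , _ , Qa , safe = a , Qa , safe
  safe-conjugate k x cofQ | no infinite with infinite-meets-cofinite em infinite cofQ
  ...   | a , central , Qa = a , Qa , λ (_ , nontrivial) →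
    nontrivial (subst (_∈ trivials x) (sym (central-conjugate x a central)) (there (here refl)))

  record Fresh (k : ℕ) (P : List C) (x a : C) : Set where
    field
      new   : ∀ s → s ∈ quad x a → s ∉ P
      large : k < index (x ∙ a)
      safe  : ∀ s t → s ∈ quad x a → t ∈ quad x a ++ P → Safe k x (s ∙ t ⁻¹)

  generic-fresh : ∀ {k P x a} → Generic k P x a → Safe k x (a ⁻¹ ∙ (x ∙ a)) → Fresh k P x a
  Fresh.new (generic-fresh (avoid , _ , _) _) s s∈ with quad-shape s∈
  ... | σ , σ∈ , refl = proj₁ (avoid σ σ∈)
  Fresh.large (generic-fresh (_ , small , _) _) = ≰⇒> small
  Fresh.safe (generic-fresh {x = x} {a} (avoid , _ , squares) conj-safe) s t s∈ t∈ with ∈-++⁻ (quad x a) t∈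
  ... | inj₁ t∈quad = form-safe squares conj-safe (quad-quotient s∈ t∈quad)
  ... | inj₂ t∈P with quad-shape s∈
  ...   | σ , σ∈ , refl = proj₂ (avoid σ σ∈) t t∈P

  -- It is opaque:
  -- the construction only uses the properties of the point, and unfolding
  -- the witness inside the recursive construction would be prohibitively costly.
  opaque
    fresh-exists : ∀ k P x → Σ C (Fresh k P x)
    fresh-exists k P x with safe-conjugate k x (generic-cofinite k P x)
    ... | a , generic , conj-safe = a , generic-fresh generic conj-safe

-- The construction of the sequence (Xₙ).

module Construction
  (em : ExcludedMiddle 0ℓ) (G : Group 0ℓ 0ℓ)
  (≈⇒≡ : ∀ {x y} → Group._≈_ G x y → x ≡ y)
  (enumeration : CountablyInfinite (Group.Carrier G))
  (few-roots : ∀ g → g ≢ Group.ε G → Finite (GroupSubsets.sqrts G g))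
  (X₀ : Subset (Group.Carrier G))
  (X₀-symmetric : X₀ ≐ GroupSubsets.invS G X₀)
  (X₀-e : X₀ (Group.ε G)) where
  open Group G using (_∙_; _⁻¹) renaming (Carrier to C; ε to e)
  open GroupSubsets G using (Δ; _·S_; _∩S_; ｛e｝)
  open GroupAlgebra G ≈⇒≡
  open Enumeration enumeration
  open GoodPoints em G ≈⇒≡ enumeration few-roots

  -- A stage of the construction: its centre x and point a contribute the
  -- four elements quad x a to X (suc level).
  record Step : Set where
    constructor step
    field
      level  : ℕ
      centre : C
      point  : C
  open Step

  contribution : Step → List C
  contribution s = quad (centre s) (point s)

  used : List Step → List C
  used h = e ∷ concatMap contribution h

  Recorded : ℕ → List Step → Subset C
  Recorded zero h g = X₀ g
  Recorded (suc n) h g = Any (λ s → level s ≡ n × g ∈ contribution s) h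

  proposal : ℕ → ℕ → List Step → C
  proposal n i h with em {Recorded n h (enum i)}
  ... | yes _ = enum i
  ... | no _ = e

  next : ℕ → List Step → Step
  next k h = step n x (proj₁ (fresh-exists k (used h) x))
    where
    n = proj₁ (schedule k)
    x = proposal n (proj₂ (schedule k)) h

  history : ℕ → List Step
  history zero = []
  history (suc k) = next k (history k) ∷ history k

  stage : ℕ → Step
  stage k = next k (history k)

  stage-fresh : ∀ k → Fresh k (used (history k)) (centre (stage k)) (point (stage k))
  stage-fresh k = proj₂ (fresh-exists k (used (history k)) (centre (stage k)))

  X : ℕ → Subset C
  X zero = X₀
  X (suc n) g = g ≡ e ⊎ Σ ℕ λ k → level (stage k) ≡ n × g ∈ contribution (stage k)

  history-stages : ∀ k {s} → s ∈ history k → Σ ℕ λ j → s ≡ stage j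
  history-stages (suc k) (here refl) = k , refl
  history-stages (suc k) (there s∈) = history-stages k s∈

  stage-in-history : ∀ {j k} → j < k → stage j ∈ history k
  stage-in-history {j} {suc k} (s≤s j≤k) with m≤n⇒m<n∨m≡n j≤k
  ... | inj₁ j<k = there (stage-in-history j<k)
  ... | inj₂ refl = here refl

  used-earlier : ∀ {j k g} → j < k → g ∈ contribution (stage j) → g ∈ used (history k)
  used-earlier j<k g∈ = there (∈-concatMap⁺ contribution (lose (stage-in-history j<k) g∈))

  e-in-X : ∀ n → X n e
  e-in-X zero = X₀-e
  e-in-X (suc n) = inj₁ refl

  symmetric : ∀ n {g} → X n g → X n (g ⁻¹)
  symmetric zero {g} Xg = Equivalence.from (X₀-symmetric (g ⁻¹)) (g , Xg , refl)
  symmetric (suc n) (inj₁ refl) = inj₁ e⁻¹≡e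
  symmetric (suc n) (inj₂ (k , lk , g∈)) = inj₂ (k , lk , quad-⁻¹ g∈)

  trivials-in-X : ∀ n {x t} → X n x → t ∈ trivials x → X n t
  trivials-in-X n _ (here refl) = e-in-X n
  trivials-in-X n Xx (there (here refl)) = Xx
  trivials-in-X n Xx (there (there (here refl))) = symmetric n Xx

  recorded-in-X : ∀ n k {g} → Recorded n (history k) g → X n g
  recorded-in-X zero k Xg = Xg
  recorded-in-X (suc n) k recorded with find recorded
  ... | s , s∈ , level≡n , g∈ with history-stages k s∈
  ...   | j , refl = inj₂ (j , level≡n , g∈)

  proposal-in-X : ∀ n i k → X n (proposal n i (history k))
  proposal-in-X n i k with em {Recorded n (history k) (enum i)}
  ... | yes recorded = recorded-in-X n k recorded
  ... | no _ = e-in-X n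

  centre-in-X : ∀ k → X (level (stage k)) (centre (stage k))
  centre-in-X k = proposal-in-X (proj₁ (schedule k)) (proj₂ (schedule k)) k

  proposal-recorded : ∀ n h {g} → Recorded n h g ⊎ g ≡ e → proposal n (index g) h ≡ g
  proposal-recorded n h {g} known with em {Recorded n h (enum (index g))}
  ... | yes _ = enum-index g
  ... | no unrecorded with known
  ...   | inj₁ recorded = ⊥-elim (unrecorded (subst (Recorded n h) (sym (enum-index g)) recorded))
  ...   | inj₂ g≡e = sym g≡e

  proposal-eventually : ∀ n {g} → X n g → Σ ℕ λ N → ∀ k → N ≤ k → proposal n (index g) (history k) ≡ g
  proposal-eventually zero Xg = 0 , λ k _ → proposal-recorded zero (history k) (inj₁ Xg)
  proposal-eventually (suc n) (inj₁ g≡e) = 0 , λ k _ → proposal-recorded (suc n) (history k) (inj₂ g≡e)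
  proposal-eventually (suc n) (inj₂ (j , lj , g∈)) =
    suc j , λ k j<k → proposal-recorded (suc n) (history k) (inj₁ (lose (stage-in-history j<k) (lj , g∈)))

  quotient-safe : ∀ {n k a b} → level (stage k) ≡ n → b ∈ contribution (stage k) → X (suc n) a →
    Σ ℕ λ m → k ≤ m × level (stage m) ≡ n × Safe m (centre (stage m)) (b ∙ a ⁻¹)
  quotient-safe {k = k} lk b∈ (inj₁ refl) =
    k , ≤-refl , lk , Fresh.safe (stage-fresh k) _ _ b∈ (∈-++⁺ʳ (contribution (stage k)) (here refl))
  quotient-safe {k = k} lk b∈ (inj₂ (j , lj , a∈)) with <-cmp j k
  ... | tri< j<k _ _ = k , ≤-refl , lk , Fresh.safe (stage-fresh k) _ _ b∈ (∈-++⁺ʳ (contribution (stage k)) (used-earlier j<k a∈))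
  ... | tri≈ _ refl _ = k , ≤-refl , lk , Fresh.safe (stage-fresh k) _ _ b∈ (∈-++⁺ˡ a∈)
  ... | tri> _ _ k<j = j , <⇒≤ k<j , lj ,
    subst (Safe j _) (quotient-⁻¹ _ _) (safe-⁻¹ (Fresh.safe (stage-fresh j) _ _ a∈ (∈-++⁺ʳ (contribution (stage j)) (used-earlier k<j b∈))))

  outside-dangerous : ∀ n m {x g} → X n x → ¬ X n g → index g ≤ m → Dangerous m x g
  outside-dangerous n m Xx ¬Xg small = inj₁ small , λ g∈ → ¬Xg (trivials-in-X n Xx g∈)

  -- Δ(Xₙ₊₁) ⊆ Xₙ: for g ∉ Xₙ, every b ∈ gXₙ₊₁ ∩ Xₙ₊₁ was used before stage index g.
  Δ-⊆ : ∀ n g → Δ (X (suc n)) g → X n g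
  Δ-⊆ n g infinite with em {X n g}
  ... | yes Xg = Xg
  ... | no ¬Xg = ⊥-elim (infinite (used (history (index g)) , early))
    where
    early : ∀ b → ((g ·S X (suc n)) ∩S X (suc n)) b → b ∈ used (history (index g))
    early b (_ , inj₁ b≡e) = here b≡e
    early b ((a , Xa , b≡ga) , inj₂ (k , lk , b∈)) with k <? index g
    ... | yes k<g = used-earlier k<g b∈
    ... | no k≮g with quotient-safe lk b∈ Xa
    ...   | m , k≤m , lm , safe = ⊥-elim (safe (subst (Dangerous m _) (sym ba⁻¹≡g) g-dangerous))
      where
      ba⁻¹≡g : b ∙ a ⁻¹ ≡ g
      ba⁻¹≡g = trans (cong (_∙ a ⁻¹) b≡ga) (cancelʳ g a)
      g-dangerous : Dangerous m (centre (stage m)) g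
      g-dangerous = outside-dangerous n m (subst (λ l → X l _) lm (centre-in-X m)) ¬Xg (≤-trans (≮⇒≥ k≮g) k≤m)

  -- Xₙ ⊆ Δ(Xₙ₊₁): at the infinitely many stages serving (n, index g) with
  -- centre g, the element g a lies in gXₙ₊₁ ∩ Xₙ₊₁ and has index above the stage.
  Δ-⊇ : ∀ n g → X n g → Δ (X (suc n)) g
  Δ-⊇ n g Xg = unbounded-infinite translates
    where
    N = proj₁ (proposal-eventually n Xg)
    translates : ∀ B → Σ C λ b → ((g ·S X (suc n)) ∩S X (suc n)) b × B ≤ index b
    translates B with schedule-recurrent (n , index g) (N + B)
    ... | k , N+B≤k , scheduled =
      centre (stage k) ∙ a ,
      ((a , inj₂ (k , lk , here refl) , cong (_∙ a) centre≡g) , inj₂ (k , lk , there (there (here refl)))) ,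
      ≤-trans (≤-trans (m≤n+m B N) N+B≤k) (<⇒≤ (Fresh.large (stage-fresh k)))
      where
      a = point (stage k)
      lk : level (stage k) ≡ n
      lk = cong proj₁ scheduled
      centre≡g : centre (stage k) ≡ g
      centre≡g = trans (cong (λ p → proposal (proj₁ p) (proj₂ p) (history k)) scheduled)
        (proj₂ (proposal-eventually n Xg) k (≤-trans (m≤m+n N B) N+B≤k))

  -- Distinct positive levels share only e, since contributions are new.
  levels-disjoint : ∀ m n → 0 < m → m < n → (X m ∩S X n) ≐ ｛e｝
  levels-disjoint (suc m) (suc n) _ m<n g = mk⇔ only-e (λ g≡e → inj₁ g≡e , inj₁ g≡e)
    where
    only-e : X (suc m) g × X (suc n) g → g ≡ e
    only-e (inj₁ g≡e , _) = g≡e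
    only-e (_ , inj₁ g≡e) = g≡e
    only-e (inj₂ (j , lj , g∈j) , inj₂ (k , lk , g∈k)) with <-cmp j k
    ... | tri< j<k _ _ = ⊥-elim (Fresh.new (stage-fresh k) g g∈k (used-earlier j<k g∈j))
    ... | tri≈ _ refl _ = ⊥-elim (<-irrefl (cong suc (trans (sym lj) lk)) m<n)
    ... | tri> _ _ k<j = ⊥-elim (Fresh.new (stage-fresh j) g g∈j (used-earlier k<j g∈k))

theorem5p4 : ExcludedMiddle 0ℓ →
    (G : Group 0ℓ 0ℓ) →
    (∀ {x y} → Group._≈_ G x y → x ≡ y) →
    CountablyInfinite (Group.Carrier G) →
    (∀ g → g ≢ Group.ε G → Finite (GroupSubsets.sqrts G g)) →
    (X₀ : Subset (Group.Carrier G)) →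
    X₀ ≐ GroupSubsets.invS G X₀ →
    X₀ (Group.ε G) →
    Σ (ℕ → Subset (Group.Carrier G)) λ X →
      (X zero ≐ X₀)
      × (∀ n → GroupSubsets.Δ G (X (suc n)) ≐ X n)
      × (∀ m n → 0 < m → m < n → (GroupSubsets._∩S_ G (X m) (X n)) ≐ GroupSubsets.｛e｝ G)
theorem5p4 em G ≈⇒≡ enumeration few-roots X₀ X₀-symmetric X₀-e =
  X , (λ _ → mk⇔ id id) , (λ n g → mk⇔ (Δ-⊆ n g) (Δ-⊇ n g)) , levels-disjoint
  where
  open Construction em G ≈⇒≡ enumeration few-roots X₀ X₀-symmetric X₀-e
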